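{- Let $n$ and $g$ be odd integers with $3 \leq g \leq n$, and let $S \subseteq \mathbb{Z}_n \setminus \{0\}$. If the circulant graph $\mathrm{Circ}(n; \pm S)$ admits a Hamiltonian decomposition, then the graph $C_g[\mathbb{Z}_n, \pm S]$ admits a $C_n$-factorization.
   Context: For $S \subseteq \mathbb{Z}_n \setminus\{0\}$, write $\pm S = \{d, -d : d \in S\}$. The circulant graph $\mathrm{Circ}(n; \pm S)$ has vertex set $\mathbb{Z}_n$, with $x$ adjacent to $x + d$ for every $x \in \mathbb{Z}_n$ and $d \in \pm S$. A Hamiltonian decomposition of a graph is a partition of its edge set into Hamilton cycles. For a group $\Gamma$ and $T \subseteq \Gamma$, $C_g[\Gamma, T]$ denotes the graph with vertex set $\mathbb{Z}_g \times \Gamma$ whose edges are $(i, x)(i+1, d + x)$ for all $i \in \mathbb{Z}_g$, $x \in \Gamma$, $d \in T$ (equivalently, the Cayley graph on $\mathbb{Z}_g \times \Gamma$ with connection set $\{1\} \times T$). A $C_n$-factor of a graph is a spanning subgraph whose components are all cycles of length $n$; a $C_n$-factorization of a graph is a set of $C_n$-factors whose edge sets partition the edge set of the graph. -}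

module Defs where

open import Data.Nat using (ℕ; zero; suc; _≤_; _∸_)
open import Data.Nat.DivMod using (_mod_)
open import Data.Fin using (Fin; toℕ)
open import Data.Fin.Subset using (Subset; _∈_; _∉_)
open import Data.Product using (Σ; ∃; ∃-syntax; _×_; _,_)
open import Data.Sum using (_⊎_)
open import Function.Definitions using (Injective)
open import Relation.Binary.PropositionalEquality using (_≡_)

infixl 6 _⊕_ _⊖_

_⊕_ : ∀ {n} → Fin n → Fin n → Fin n
_⊕_ {suc n} x y = (toℕ x Data.Nat.+ toℕ y) mod suc n

⊝_ : ∀ {n} → Fin n → Fin n
⊝_ {suc n} x = (suc n ∸ toℕ x) mod suc n

_⊖_ : ∀ {n} → Fin n → Fin n → Fin n
x ⊖ y = x ⊕ (⊝ y)

one : ∀ {n} → Fin n → Fin n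
one {suc n} x = suc (toℕ x) mod suc n

_∈±_ : ∀ {n} → Fin n → Subset n → Set
e ∈± S = ∃[ d ] (d ∈ S × (e ≡ d ⊎ e ≡ ⊝ d))

record Graph : Set₁ where
  field
    V   : Set
    Adj : V → V → Set

open Graph public

Circ : (n : ℕ) → Subset n → Graph
Circ n S = record
  { V   = Fin n
  ; Adj = λ x y → ∃[ e ] (e ∈± S × y ≡ x ⊕ e) }

Cg : (g n : ℕ) → Subset n → Graph
Cg g n S = record
  { V   = Fin g × Fin n
  ; Adj = λ { (i , x) (j , y) →
        (j ≡ one i × ∃[ e ] (e ∈± S × y ≡ x ⊕ e))
      ⊎ (i ≡ one j × ∃[ e ] (e ∈± S × x ≡ y ⊕ e)) } }

record Cycle (G : Graph) (m : ℕ) : Set where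
  field
    len≥3  : 3 ≤ m
    vert   : Fin m → V G
    inj    : Injective _≡_ _≡_ vert
    adj    : ∀ i → Adj G (vert i) (vert (one i))

open Cycle public

_∋edge_─_ : ∀ {G m} → Cycle G m → V G → V G → Set
C ∋edge u ─ v = ∃[ i ] ((vert C i ≡ u × vert C (one i) ≡ v)
                       ⊎ (vert C i ≡ v × vert C (one i) ≡ u))

ExactlyOne : (I : Set) → (I → Set) → Set
ExactlyOne I P = ∃[ i ] (P i × (∀ j → P j → j ≡ i))

-- A family of cycles partitions the edge set of G: every cycle edge is an
-- edge of G (built into Cycle), and every edge of G lies in exactly one
-- cycle of the family.
EdgePartition : (G : Graph) {m : ℕ} (I : Set) → (I → Cycle G m) → Set
EdgePartition G I C = ∀ u v → Adj G u v → ExactlyOne I (λ i → C i ∋edge u ─ v)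

record HamCycle (G : Graph) : Set where
  field
    length : ℕ
    cyc    : Cycle G length
    spanning : ∀ v → ∃[ i ] (vert cyc i ≡ v)

open HamCycle public

HamiltonianDecomposition : Graph → Set
HamiltonianDecomposition G =
  ∃[ t ] Σ (Fin t → HamCycle G) (λ H →
    ∀ u v → Adj G u v → ExactlyOne (Fin t) (λ k → cyc (H k) ∋edge u ─ v))

record CFactor (m : ℕ) (G : Graph) : Set where
  field
    count  : ℕ
    cycles : Fin count → Cycle G m
    spans  : ∀ v → ExactlyOne (Fin count) (λ k → ∃[ i ] (vert (cycles k) i ≡ v))

open CFactor public

CFactorization : (m : ℕ) (G : Graph) → Set
CFactorization m G =
  ∃[ t ] Σ (Fin t → CFactor m G) (λ F →
    EdgePartition G (Σ (Fin t) (λ k → Fin (count (F k))))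
                    (λ { (k , j) → cycles (F k) j }))

Odd : ℕ → Set
Odd m = ∃[ k ] (m ≡ suc (2 Data.Nat.* k))

{-# OPTIONS --safe #-}
-- A Hamilton cycle v₀ … v_{n-1} of Circ(n; ±S) lifts to the g disjoint n-cycles
-- (c + f(j) , v_j), c ∈ ℤ_g, of C_g[ℤ_n, ±S] whenever f : ℤ_n → ℤ_g changes by ±1 at
-- every step; together they form a C_n-factor. For odd n and g with g ≤ n, a zigzag of
-- height (n + g)/2 is such an f, and so is its mirror image, which steps up exactly where
-- f steps down. An edge (i , x)(i + 1 , y) lies over the edge xy of exactly one Hamilton
-- cycle; the direction in which that cycle traverses xy selects f or its mirror, and the
-- level i selects c. So t Hamilton cycles yield the 2t factors of a C_n-factorization.
module Submission where

open import Defs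
open import Data.Bool using (Bool; true; false; not; T; if_then_else_)
open import Data.Bool.Properties using (not-involutive)
open import Data.Empty using (⊥-elim)
open import Data.Fin using (Fin; toℕ; splitAt; join)
open import Data.Fin.Properties
  using (toℕ<n; toℕ-injective; toℕ-fromℕ<; injective⇒≤; splitAt-join; join-splitAt)
open import Data.Fin.Subset using (Subset; _∉_)
open import Data.Nat using (ℕ; suc; _+_; _*_; _∸_; _⊓_; _≤_; _<_; _<ᵇ_; NonZero; z≤n; s≤s)
open import Data.Nat.DivMod using (_%_; _mod_; %-distribˡ-+; m%n%n≡m%n; [m+n]%n≡m%n; m%n<n; m<n⇒m%n≡m; n%n≡0)
open import Data.Nat.Properties
open import Data.Nat.Tactic.RingSolver using (solve-∀)
open import Data.Product using (Σ; ∃-syntax; _×_; _,_; proj₁; proj₂)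
open import Data.Sum using (inj₁; inj₂; [_,_]′)
open import Data.Unit using (tt)
open import Function using (id; _∘′_)
open import Relation.Binary.Bundles using (Setoid)
open import Relation.Binary.PropositionalEquality
import Relation.Binary.Reasoning.Setoid as SetoidReasoning

module Congruence (m : ℕ) .{{_ : NonZero m}} where

  infix 4 _≋_
  record _≋_ (a b : ℕ) : Set where
    constructor mk≋
    field %-≡ : a % m ≡ b % m

  ≋-setoid : Setoid _ _
  ≋-setoid = record
    { Carrier       = ℕ
    ; _≈_           = _≋_
    ; isEquivalence = record
      { refl  = mk≋ refl
      ; sym   = λ (mk≋ p) → mk≋ (sym p)
      ; trans = λ (mk≋ p) (mk≋ q) → mk≋ (trans p q)
      }
    }

  open Setoid ≋-setoid public using () renaming (refl to ≋-refl; trans to ≋-trans)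
  module ≋-Reasoning = SetoidReasoning ≋-setoid

  ≡⇒≋ : ∀ {a b} → a ≡ b → a ≋ b
  ≡⇒≋ refl = ≋-refl

  +-cong : ∀ {a b c d} → a ≋ b → c ≋ d → a + c ≋ b + d
  +-cong {a} {b} {c} {d} (mk≋ p) (mk≋ q) = mk≋ (begin
    (a + c) % m          ≡⟨ %-distribˡ-+ a c m ⟩
    (a % m + c % m) % m  ≡⟨ cong₂ (λ u v → (u + v) % m) p q ⟩
    (b % m + d % m) % m  ≡⟨ %-distribˡ-+ b d m ⟨
    (b + d) % m          ∎)
    where open ≡-Reasoning

  +-congˡ : ∀ a {b c} → b ≋ c → a + b ≋ a + c
  +-congˡ a = +-cong (≋-refl {a})

  %-≋ : ∀ a → a % m ≋ a
  %-≋ a = mk≋ (m%n%n≡m%n a m)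

  +m-≋ : ∀ a → a + m ≋ a
  +m-≋ a = mk≋ ([m+n]%n≡m%n a m)

  complement : ℕ → ℕ
  complement c = m ∸ c % m

  +-complement : ∀ c → c + complement c ≋ 0
  +-complement c = begin
    c + complement c     ≈⟨ +-cong (%-≋ c) ≋-refl ⟨
    c % m + (m ∸ c % m)  ≡⟨ m+[n∸m]≡n (<⇒≤ (m%n<n c m)) ⟩
    m                    ≈⟨ +m-≋ 0 ⟩
    0                    ∎
    where open ≋-Reasoning

  +-complement-cancelʳ : ∀ a c → a + c + complement c ≋ a
  +-complement-cancelʳ a c = begin
    a + c + complement c    ≡⟨ +-assoc a c _ ⟩
    a + (c + complement c)  ≈⟨ +-congˡ a (+-complement c) ⟩
    a + 0                   ≡⟨ +-identityʳ a ⟩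
    a                       ∎
    where open ≋-Reasoning

  complement-+-cancelʳ : ∀ a c → a + complement c + c ≋ a
  complement-+-cancelʳ a c = begin
    a + complement c + c    ≡⟨ +-assoc a _ c ⟩
    a + (complement c + c)  ≡⟨ cong (a +_) (+-comm _ c) ⟩
    a + (c + complement c)  ≡⟨ +-assoc a c _ ⟨
    a + c + complement c    ≈⟨ +-complement-cancelʳ a c ⟩
    a                       ∎
    where open ≋-Reasoning

  +-cancelʳ : ∀ {a b} c → a + c ≋ b + c → a ≋ b
  +-cancelʳ {a} {b} c p = begin
    a                     ≈⟨ +-complement-cancelʳ a c ⟨
    a + c + complement c  ≈⟨ +-cong p ≋-refl ⟩
    b + c + complement c  ≈⟨ +-complement-cancelʳ b c ⟩
    b                     ∎
    where open ≋-Reasoning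

  +-balance-suc : ∀ {x y x′ y′} → x + y ≡ x′ + y′ → x′ ≋ suc x → y ≋ suc y′
  +-balance-suc {x} {y} {x′} {y′} e s = +-cancelʳ x′ (begin
    y + x′         ≈⟨ +-congˡ y s ⟩
    y + suc x      ≡⟨ +-suc y x ⟩
    suc (y + x)    ≡⟨ cong suc (trans (+-comm y x) e) ⟩
    suc (x′ + y′)  ≡⟨ cong suc (+-comm x′ y′) ⟩
    suc y′ + x′    ∎)
    where open ≋-Reasoning

  toℕ-mod : ∀ a → toℕ (a mod m) ≡ a % m
  toℕ-mod a = toℕ-fromℕ< (m%n<n a m)

  toℕ-mod-≋ : ∀ a → toℕ (a mod m) ≋ a
  toℕ-mod-≋ a = ≋-trans (≡⇒≋ (toℕ-mod a)) (%-≋ a)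

  <-≋⇒≡ : ∀ {a b} → a < m → b < m → a ≋ b → a ≡ b
  <-≋⇒≡ a<m b<m (mk≋ p) = trans (sym (m<n⇒m%n≡m a<m)) (trans p (m<n⇒m%n≡m b<m))

  toℕ-≋⇒≡ : ∀ {x y : Fin m} → toℕ x ≋ toℕ y → x ≡ y
  toℕ-≋⇒≡ {x} {y} p = toℕ-injective (<-≋⇒≡ (toℕ<n x) (toℕ<n y) p)

module _ {N : ℕ} where
  private
    M = suc N
  open Congruence M

  toℕ-one-≋ : (x : Fin M) → toℕ (one x) ≋ suc (toℕ x)
  toℕ-one-≋ x = toℕ-mod-≋ (suc (toℕ x))

  toℕ-one-< : (x : Fin M) → suc (toℕ x) < M → toℕ (one x) ≡ suc (toℕ x)
  toℕ-one-< x lt = trans (toℕ-mod (suc (toℕ x))) (m<n⇒m%n≡m lt)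

  toℕ-one-last : (x : Fin M) → suc (toℕ x) ≡ M → toℕ (one x) ≡ 0
  toℕ-one-last x last = trans (toℕ-mod (suc (toℕ x))) (trans (cong (_% M) last) (n%n≡0 M))

  one∘one≢id : 3 ≤ M → (x : Fin M) → one (one x) ≢ x
  one∘one≢id 3≤M x eq with <-≋⇒≡ 3≤M (s≤s z≤n) (+-cancelʳ (toℕ x) 2+x≋x)
    where
      2+x≋x : 2 + toℕ x ≋ toℕ x
      2+x≋x = begin
        suc (suc (toℕ x))      ≈⟨ +-congˡ 1 (toℕ-one-≋ x) ⟨
        suc (toℕ (one x))      ≈⟨ toℕ-one-≋ (one x) ⟨
        toℕ (one (one x))      ≡⟨ cong toℕ eq ⟩
        toℕ x                  ∎
        where open ≋-Reasoning
  ... | ()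

  +-⊝-≋0 : (x : Fin M) → toℕ x + toℕ (⊝ x) ≋ 0
  +-⊝-≋0 x = begin
    toℕ x + toℕ (⊝ x)    ≈⟨ +-congˡ (toℕ x) (toℕ-mod-≋ (M ∸ toℕ x)) ⟩
    toℕ x + (M ∸ toℕ x)  ≡⟨ m+[n∸m]≡n (<⇒≤ (toℕ<n x)) ⟩
    M                    ≈⟨ +m-≋ 0 ⟩
    0                    ∎
    where open ≋-Reasoning

  ⊝-involutive : (x : Fin M) → ⊝ (⊝ x) ≡ x
  ⊝-involutive x = toℕ-≋⇒≡ (+-cancelʳ (toℕ (⊝ x)) (begin
    toℕ (⊝ (⊝ x)) + toℕ (⊝ x)  ≡⟨ +-comm _ (toℕ (⊝ x)) ⟩
    toℕ (⊝ x) + toℕ (⊝ (⊝ x))  ≈⟨ +-⊝-≋0 (⊝ x) ⟩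
    0                          ≈⟨ +-⊝-≋0 x ⟨
    toℕ x + toℕ (⊝ x)          ∎))
    where open ≋-Reasoning

  ⊕-⊖-cancel : (x e : Fin M) → x ⊕ e ⊖ e ≡ x
  ⊕-⊖-cancel x e = toℕ-≋⇒≡ (begin
    toℕ (x ⊕ e ⊖ e)               ≈⟨ toℕ-mod-≋ _ ⟩
    toℕ (x ⊕ e) + toℕ (⊝ e)       ≈⟨ +-cong (toℕ-mod-≋ (toℕ x + toℕ e)) ≋-refl ⟩
    toℕ x + toℕ e + toℕ (⊝ e)     ≡⟨ +-assoc (toℕ x) _ _ ⟩
    toℕ x + (toℕ e + toℕ (⊝ e))   ≈⟨ +-congˡ (toℕ x) (+-⊝-≋0 e) ⟩
    toℕ x + 0                     ≡⟨ +-identityʳ _ ⟩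
    toℕ x                         ∎)
    where open ≋-Reasoning

  ∈±-⊝ : {S : Subset M} {e : Fin M} → e ∈± S → (⊝ e) ∈± S
  ∈±-⊝ (d , d∈S , inj₁ refl) = d , d∈S , inj₂ refl
  ∈±-⊝ (d , d∈S , inj₂ refl) = d , d∈S , inj₁ (⊝-involutive d)

  Circ-sym : {S : Subset M} {x y : Fin M} → Adj (Circ M S) x y → Adj (Circ M S) y x
  Circ-sym {x = x} (e , e∈±S , refl) = ⊝ e , ∈±-⊝ e∈±S , sym (⊕-⊖-cancel x e)

module _ {I : Set} {P : I → Set} where

  ExactlyOne-map : {Q : I → Set} → (∀ i → P i → Q i) → (∀ i → Q i → P i) →
                   ExactlyOne I P → ExactlyOne I Q
  ExactlyOne-map to from (i , pᵢ , unique) = i , to i pᵢ , λ j qⱼ → unique j (from j qⱼ)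

  ExactlyOne-reindex : {J : Set} (f : J → I) (f⁻¹ : I → J) →
                       (∀ i → f (f⁻¹ i) ≡ i) → (∀ j → f⁻¹ (f j) ≡ j) →
                       ExactlyOne I P → ExactlyOne J (λ j → P (f j))
  ExactlyOne-reindex f f⁻¹ f∘f⁻¹ f⁻¹∘f (i , pᵢ , unique) =
    f⁻¹ i , subst P (sym (f∘f⁻¹ i)) pᵢ ,
    λ j p-fj → trans (sym (f⁻¹∘f j)) (cong f⁻¹ (unique (f j) p-fj))

  ExactlyOne-× : {J : Set} {Q : I → J → Set} → ExactlyOne I P →
                 (∀ i → P i → ExactlyOne J (Q i)) → (∀ i j → Q i j → P i) →
                 ExactlyOne (I × J) (λ (i , j) → Q i j)
  ExactlyOne-× {Q = Q} (i , pᵢ , uniqueᵢ) fibre Q⇒P with fibre i pᵢ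
  ... | j , qᵢⱼ , uniqueⱼ = (i , j) , qᵢⱼ , unique
    where
      unique : ∀ ij → Q (proj₁ ij) (proj₂ ij) → ij ≡ (i , j)
      unique (i′ , j′) q with uniqueᵢ i′ (Q⇒P i′ j′ q)
      ... | refl = cong (i ,_) (uniqueⱼ j′ q)

-- The c-th lift of a cycle v₀ … v_{n-1} of Circ(n; ±S) is the cycle (c + height j , v_j)
-- of C_g[ℤ_n, ±S].
record LevelProfile (G n : ℕ) : Set where
  open Congruence (suc G) using (_≋_; complement)
  field
    height  : Fin n → ℕ
    ascends : Fin n → Bool
    ascend  : ∀ j → ascends j ≡ true → height (one j) ≋ suc (height j)
    descend : ∀ j → ascends j ≡ false → height j ≋ suc (height (one j))

  level : Fin (suc G) → Fin n → Fin (suc G)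
  level c j = (toℕ c + height j) mod suc G

  level⁻¹ : Fin n → Fin (suc G) → Fin (suc G)
  level⁻¹ j i = (toℕ i + complement (height j)) mod suc G

module _ {G n : ℕ} (P : LevelProfile G n) where
  private
    g = suc G
  open LevelProfile P
  open Congruence g
  open ≋-Reasoning

  level-suc : ∀ c {j j′} → height j′ ≋ suc (height j) → level c j′ ≡ one (level c j)
  level-suc c {j} {j′} step = toℕ-≋⇒≡ (begin
    toℕ (level c j′)         ≈⟨ toℕ-mod-≋ _ ⟩
    toℕ c + height j′        ≈⟨ +-congˡ (toℕ c) step ⟩
    toℕ c + suc (height j)   ≡⟨ +-suc (toℕ c) _ ⟩
    suc (toℕ c + height j)   ≈⟨ +-congˡ 1 (toℕ-mod-≋ _) ⟨
    suc (toℕ (level c j))    ≈⟨ toℕ-one-≋ (level c j) ⟨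
    toℕ (one (level c j))    ∎)

  level-ascend : ∀ c j → ascends j ≡ true → level c (one j) ≡ one (level c j)
  level-ascend c j a = level-suc c (ascend j a)

  level-descend : ∀ c j → ascends j ≡ false → level c j ≡ one (level c (one j))
  level-descend c j d = level-suc c (descend j d)

  level-level⁻¹ : ∀ j i → level (level⁻¹ j i) j ≡ i
  level-level⁻¹ j i = toℕ-≋⇒≡ (begin
    toℕ (level (level⁻¹ j i) j)               ≈⟨ toℕ-mod-≋ _ ⟩
    toℕ (level⁻¹ j i) + height j              ≈⟨ +-cong (toℕ-mod-≋ (toℕ i + complement (height j))) ≋-refl ⟩
    toℕ i + complement (height j) + height j  ≈⟨ complement-+-cancelʳ (toℕ i) (height j) ⟩
    toℕ i                                     ∎)

  level⁻¹-level : ∀ c j → level⁻¹ j (level c j) ≡ c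
  level⁻¹-level c j = toℕ-≋⇒≡ (begin
    toℕ (level⁻¹ j (level c j))                ≈⟨ toℕ-mod-≋ _ ⟩
    toℕ (level c j) + complement (height j)    ≈⟨ +-cong (toℕ-mod-≋ (toℕ c + height j)) ≋-refl ⟩
    toℕ c + height j + complement (height j)   ≈⟨ +-complement-cancelʳ (toℕ c) (height j) ⟩
    toℕ c                                      ∎)

  mirror : (K : ℕ) → (∀ j → height j ≤ K) → LevelProfile G n
  mirror K height≤K = record
    { height  = λ j → K ∸ height j
    ; ascends = λ j → not (ascends j)
    ; ascend  = λ j a → +-balance-suc (balance (one j) j) (descend j (not-flip a))
    ; descend = λ j d → +-balance-suc (balance j (one j)) (ascend j (not-flip d))
    }
    where
      balance : ∀ j j′ → height j + (K ∸ height j) ≡ height j′ + (K ∸ height j′)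
      balance j j′ = trans (m+[n∸m]≡n (height≤K j)) (sym (m+[n∸m]≡n (height≤K j′)))
      not-flip : ∀ {b c} → not b ≡ c → b ≡ not c
      not-flip {b} e = trans (sym (not-involutive b)) (cong not e)

  mirrorPair : (K : ℕ) → (∀ j → height j ≤ K) → Bool → LevelProfile G n
  mirrorPair K height≤K true  = P
  mirrorPair K height≤K false = mirror K height≤K

  mirrorPair-directions : ∀ K height≤K j d →
    ExactlyOne Bool (λ b → LevelProfile.ascends (mirrorPair K height≤K b) j ≡ d)
  mirrorPair-directions K height≤K j d =
    ExactlyOne-map (λ { true p → p ; false p → p }) (λ { true p → p ; false p → p })
                   (selection-unique (ascends j) d)
    where
      selection-unique : ∀ a d → ExactlyOne Bool (λ b → (if b then a else not a) ≡ d)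
      selection-unique true  true  = true  , refl , λ { true _ → refl ; false () }
      selection-unique true  false = false , refl , λ { true () ; false _ → refl }
      selection-unique false true  = false , refl , λ { true () ; false _ → refl }
      selection-unique false false = true  , refl , λ { true _ → refl ; false () }

module _ {G : Graph} where

  Spanning : ∀ {m} → Cycle G m → Set
  Spanning C = ∀ v → ∃[ j ] (vert C j ≡ v)

  Traverses : ∀ {m} → Cycle G m → Fin m → Bool → V G → V G → Set
  Traverses C j true  x y = vert C j ≡ x × vert C (one j) ≡ y
  Traverses C j false x y = vert C j ≡ y × vert C (one j) ≡ x

  ∋edge⇒Traverses : ∀ {m} {C : Cycle G m} {x y} → C ∋edge x ─ y → ∃[ j ] ∃[ d ] Traverses C j d x y
  ∋edge⇒Traverses (j , inj₁ t) = j , true , t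
  ∋edge⇒Traverses (j , inj₂ t) = j , false , t

  Traverses⇒∋edge : ∀ {m} {C : Cycle G m} {x y} j d → Traverses C j d x y → C ∋edge x ─ y
  Traverses⇒∋edge j true  t = j , inj₁ t
  Traverses⇒∋edge j false t = j , inj₂ t

  ∋edge-sym : ∀ {m} {C : Cycle G m} {x y} → C ∋edge x ─ y → C ∋edge y ─ x
  ∋edge-sym (j , inj₁ t) = j , inj₂ t
  ∋edge-sym (j , inj₂ t) = j , inj₁ t

  Traverses-unique : ∀ {N} (C : Cycle G (suc N)) {x y j₁ j₂} d₁ d₂ →
                     Traverses C j₁ d₁ x y → Traverses C j₂ d₂ x y → j₁ ≡ j₂ × d₁ ≡ d₂
  Traverses-unique C true  true  (x₁ , _) (x₂ , _) = inj C (trans x₁ (sym x₂)) , refl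
  Traverses-unique C false false (y₁ , _) (y₂ , _) = inj C (trans y₁ (sym y₂)) , refl
  Traverses-unique C {j₁ = j₁} true false (x₁ , y₁) (y₂ , x₂)
    with inj C (trans y₁ (sym y₂)) | inj C (trans x₂ (sym x₁))
  ... | refl | two-steps = ⊥-elim (one∘one≢id (len≥3 C) j₁ two-steps)
  Traverses-unique C {j₂ = j₂} false true (y₁ , x₁) (x₂ , y₂)
    with inj C (trans y₂ (sym y₁)) | inj C (trans x₁ (sym x₂))
  ... | refl | two-steps = ⊥-elim (one∘one≢id (len≥3 C) j₂ two-steps)

  record Resized {L : ℕ} (m : ℕ) (D : Cycle G L) : Set where
    field
      cycle     : Cycle G m
      spanning⇒ : Spanning D → Spanning cycle
      edge⇒     : ∀ {x y} → D ∋edge x ─ y → cycle ∋edge x ─ y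
      edge⇐     : ∀ {x y} → cycle ∋edge x ─ y → D ∋edge x ─ y

  resize : ∀ {L m} → L ≡ m → (D : Cycle G L) → Resized m D
  resize refl D = record { cycle = D ; spanning⇒ = id ; edge⇒ = id ; edge⇐ = id }

HamCycle-length : ∀ {n} {S : Subset n} (H : HamCycle (Circ n S)) → length H ≡ n
HamCycle-length H = ≤-antisym (injective⇒≤ (inj (cyc H))) (injective⇒≤ position-injective)
  where
    position-injective : ∀ {x y} → proj₁ (spanning H x) ≡ proj₁ (spanning H y) → x ≡ y
    position-injective {x} {y} e =
      trans (sym (proj₂ (spanning H x))) (trans (cong (vert (cyc H)) e) (proj₂ (spanning H y)))

module Lifting {N G : ℕ} {S : Subset (suc N)} (C : Cycle (Circ (suc N) S) (suc N)) where
  private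
    n = suc N
    g = suc G

  lowerEnd : Fin n → Bool → Fin n
  lowerEnd j true  = j
  lowerEnd j false = one j

  module _ (P : LevelProfile G n) where
    open LevelProfile P

    liftCycle : Fin g → Cycle (Cg g n S) n
    liftCycle c = record
      { len≥3 = len≥3 C
      ; vert  = λ j → level c j , vert C j
      ; inj   = λ e → inj C (cong proj₂ e)
      ; adj   = lift-adj
      }
      where
        lift-adj : ∀ j → Adj (Cg g n S) (level c j , vert C j) (level c (one j) , vert C (one j))
        lift-adj j with ascends j in a
        ... | true  = inj₁ (level-ascend P c j a , adj C j)
        ... | false = inj₂ (level-descend P c j a , Circ-sym (adj C j))

    liftFactor : Spanning C → CFactor n (Cg g n S)
    liftFactor spanning-C = record { count = g ; cycles = liftCycle ; spans = covers }
      where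
        covers : ∀ v → ExactlyOne (Fin g) (λ c → ∃[ j ] (vert (liftCycle c) j ≡ v))
        covers (i , x) with spanning-C x
        ... | j , vⱼ≡x = level⁻¹ j i , (j , cong₂ _,_ (level-level⁻¹ P j i) vⱼ≡x) , unique
          where
            unique : ∀ c → ∃[ j′ ] (vert (liftCycle c) j′ ≡ (i , x)) → c ≡ level⁻¹ j i
            unique c (j′ , e) with inj C (trans (cong proj₂ e) (sym vⱼ≡x))
            ... | refl = trans (sym (level⁻¹-level P c j)) (cong (level⁻¹ j) (cong proj₁ e))

    liftCycle-project : ∀ {c i i′ x y} → liftCycle c ∋edge (i , x) ─ (i′ , y) → C ∋edge x ─ y
    liftCycle-project (j , inj₁ (eⱼ , eⱼ₊₁)) = j , inj₁ (cong proj₂ eⱼ , cong proj₂ eⱼ₊₁)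
    liftCycle-project (j , inj₂ (eⱼ , eⱼ₊₁)) = j , inj₂ (cong proj₂ eⱼ , cong proj₂ eⱼ₊₁)

    LiftedEdge : Fin g → Fin g → Fin n → Fin n → Set
    LiftedEdge c i x y = ∃[ j ] ∃[ d ]
      (Traverses C j d x y × ascends j ≡ d × level c (lowerEnd j d) ≡ i)

    LiftedEdge⇒∋edge : ∀ {c i x y} → LiftedEdge c i x y → liftCycle c ∋edge (i , x) ─ (one i , y)
    LiftedEdge⇒∋edge {c} (j , true , (vⱼ≡x , vⱼ₊₁≡y) , a , lⱼ≡i) =
      Traverses⇒∋edge {C = liftCycle c} j true
        ( cong₂ _,_ lⱼ≡i vⱼ≡x
        , cong₂ _,_ (trans (level-ascend P c j a) (cong one lⱼ≡i)) vⱼ₊₁≡y )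
    LiftedEdge⇒∋edge {c} (j , false , (vⱼ≡y , vⱼ₊₁≡x) , d , lⱼ₊₁≡i) =
      Traverses⇒∋edge {C = liftCycle c} j false
        ( cong₂ _,_ (trans (level-descend P c j d) (cong one lⱼ₊₁≡i)) vⱼ≡y
        , cong₂ _,_ lⱼ₊₁≡i vⱼ₊₁≡x )

    -- For g ≥ 3 a level cannot step back to its predecessor, so the direction of
    -- the lifted edge is forced by the profile.
    ∋edge⇒LiftedEdge : 3 ≤ g → ∀ {c i x y} → liftCycle c ∋edge (i , x) ─ (one i , y) →
                       LiftedEdge c i x y
    ∋edge⇒LiftedEdge 3≤g {c} {i} e with ∋edge⇒Traverses {C = liftCycle c} e
    ... | j , true , (lowⱼ , highⱼ₊₁) with ascends j in a
    ...   | true  = j , true , (cong proj₂ lowⱼ , cong proj₂ highⱼ₊₁) , a , cong proj₁ lowⱼ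
    ...   | false = ⊥-elim (one∘one≢id 3≤g i (sym (begin
            i                         ≡⟨ cong proj₁ lowⱼ ⟨
            level c j                 ≡⟨ level-descend P c j a ⟩
            one (level c (one j))     ≡⟨ cong (one ∘′ proj₁) highⱼ₊₁ ⟩
            one (one i)               ∎)))
      where open ≡-Reasoning
    ∋edge⇒LiftedEdge 3≤g {c} {i} e
      | j , false , (highⱼ , lowⱼ₊₁) with ascends j in a
    ...   | false = j , false , (cong proj₂ highⱼ , cong proj₂ lowⱼ₊₁) , a , cong proj₁ lowⱼ₊₁
    ...   | true  = ⊥-elim (one∘one≢id 3≤g i (sym (begin
            i                         ≡⟨ cong proj₁ lowⱼ₊₁ ⟨
            level c (one j)           ≡⟨ level-ascend P c j a ⟩
            one (level c j)           ≡⟨ cong (one ∘′ proj₁) highⱼ ⟩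
            one (one i)               ∎)))
      where open ≡-Reasoning

  lift-cover : 3 ≤ g → {B : Set} (Ps : B → LevelProfile G n) →
               (∀ j d → ExactlyOne B (λ b → LevelProfile.ascends (Ps b) j ≡ d)) →
               ∀ {i x y} → C ∋edge x ─ y →
               ExactlyOne (B × Fin g) (λ (b , c) → liftCycle (Ps b) c ∋edge (i , x) ─ (one i , y))
  lift-cover 3≤g Ps directions {i} {x} {y} e with ∋edge⇒Traverses e
  ... | j , d , t with directions j d
  ... | b , ascendsᵦ , unique-b =
    (b , c) ,
    LiftedEdge⇒∋edge (Ps b) {c} (j , d , t , ascendsᵦ , level-level⁻¹ (Ps b) (lowerEnd j d) i) ,
    unique
    where
      open LevelProfile (Ps b) using (level⁻¹)
      c = level⁻¹ (lowerEnd j d) i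
      unique : ∀ bc → liftCycle (Ps (proj₁ bc)) (proj₂ bc) ∋edge (i , x) ─ (one i , y) → bc ≡ (b , c)
      unique (b′ , c′) e′ with ∋edge⇒LiftedEdge (Ps b′) 3≤g {c′} e′
      ... | j′ , d′ , t′ , ascendsᵦ′ , level≡i with Traverses-unique C d′ d t′ t
      ... | refl , refl with unique-b b′ ascendsᵦ′
      ... | refl = cong (b ,_)
        (trans (sym (level⁻¹-level (Ps b) c′ (lowerEnd j d))) (cong (level⁻¹ (lowerEnd j d)) level≡i))

-- Heights climb 0, 1, …, h and then descend; since n + g = 2h, the wrap-around step
-- v_{n-1} → v₀ is still ±1 modulo g.
module Zigzag {N G : ℕ} (h : ℕ) (n+g≡h+h : suc N + suc G ≡ h + h) (g≤n : suc G ≤ suc N) where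
  private
    n = suc N
    g = suc G
    K = h + h
  open Congruence g

  zigzag : ℕ → ℕ
  zigzag x = x ⊓ (K ∸ x)

  zigzag-≤ : ∀ {x} → x ≤ h → zigzag x ≡ x
  zigzag-≤ {x} x≤h =
    m≤n⇒m⊓n≡m (subst (_≤ K ∸ x) (m+n∸m≡n x x) (∸-monoˡ-≤ x (+-mono-≤ x≤h x≤h)))

  zigzag-≥ : ∀ {x} → h ≤ x → zigzag x ≡ K ∸ x
  zigzag-≥ {x} h≤x =
    m≥n⇒m⊓n≡n (subst (K ∸ x ≤_) (m+n∸m≡n x x) (∸-monoˡ-≤ x (+-mono-≤ h≤x h≤x)))

  zigzag-≤K : ∀ x → zigzag x ≤ K
  zigzag-≤K x = ≤-trans (m⊓n≤n x (K ∸ x)) (m∸n≤m K x)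

  zigzag-suc-below : ∀ {x} → suc x ≤ h → zigzag (suc x) ≡ suc (zigzag x)
  zigzag-suc-below {x} x<h = trans (zigzag-≤ x<h) (cong suc (sym (zigzag-≤ (<⇒≤ x<h))))

  zigzag-suc-above : ∀ {x} → h ≤ x → suc x ≤ K → zigzag x ≡ suc (zigzag (suc x))
  zigzag-suc-above {x} h≤x x<K = begin
    zigzag x                ≡⟨ zigzag-≥ h≤x ⟩
    K ∸ x                   ≡⟨ +-∸-assoc 1 x<K ⟩
    suc (K ∸ suc x)         ≡⟨ cong suc (zigzag-≥ (≤-trans h≤x (n≤1+n x))) ⟨
    suc (zigzag (suc x))    ∎
    where open ≡-Reasoning

  n≤K : n ≤ K
  n≤K = subst (n ≤_) n+g≡h+h (m≤m+n n g)

  n≤h⇒n≡g : n ≤ h → n ≡ g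
  n≤h⇒n≡g n≤h =
    ≤-antisym (+-cancelˡ-≤ n n g (subst (n + n ≤_) (sym n+g≡h+h) (+-mono-≤ n≤h n≤h))) g≤n

  K∸last : ∀ {x} → suc x ≡ n → K ∸ x ≡ suc g
  K∸last {x} last = begin
    K ∸ x            ≡⟨ cong (_∸ x) n+g≡h+h ⟨
    n + g ∸ x        ≡⟨ cong (λ m → m + g ∸ x) last ⟨
    suc x + g ∸ x    ≡⟨ cong (_∸ x) (+-suc x g) ⟨
    x + suc g ∸ x    ≡⟨ m+n∸m≡n x (suc g) ⟩
    suc g            ∎
    where open ≡-Reasoning

  below : Fin n → Bool
  below j = toℕ j <ᵇ h

  below⇒< : ∀ {j} → below j ≡ true → toℕ j < h
  below⇒< {j} b = <ᵇ⇒< (toℕ j) h (subst T (sym b) tt)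

  ¬below⇒≥ : ∀ {j} → below j ≡ false → h ≤ toℕ j
  ¬below⇒≥ ¬b = ≮⇒≥ (λ lt → subst T ¬b (<⇒<ᵇ lt))

  zigzag-ascend : ∀ j → below j ≡ true → zigzag (toℕ (one j)) ≋ suc (zigzag (toℕ j))
  zigzag-ascend j b with m≤n⇒m<n∨m≡n (toℕ<n j)
  ... | inj₁ j+1<n = ≡⇒≋ (begin
    zigzag (toℕ (one j))   ≡⟨ cong zigzag (toℕ-one-< j j+1<n) ⟩
    zigzag (suc (toℕ j))   ≡⟨ zigzag-suc-below (below⇒< b) ⟩
    suc (zigzag (toℕ j))   ∎)
    where open ≡-Reasoning
  ... | inj₂ last = begin
    zigzag (toℕ (one j))   ≡⟨ cong zigzag (toℕ-one-last j last) ⟩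
    0                      ≈⟨ +m-≋ 0 ⟨
    g                      ≡⟨ n≤h⇒n≡g (subst (_≤ h) last (below⇒< b)) ⟨
    n                      ≡⟨ last ⟨
    suc (toℕ j)            ≡⟨ cong suc (zigzag-≤ (<⇒≤ (below⇒< b))) ⟨
    suc (zigzag (toℕ j))   ∎
    where open ≋-Reasoning

  zigzag-descend : ∀ j → below j ≡ false → zigzag (toℕ j) ≋ suc (zigzag (toℕ (one j)))
  zigzag-descend j ¬b with m≤n⇒m<n∨m≡n (toℕ<n j)
  ... | inj₁ j+1<n = ≡⇒≋ (begin
    zigzag (toℕ j)               ≡⟨ zigzag-suc-above (¬below⇒≥ ¬b) (≤-trans (toℕ<n j) n≤K) ⟩
    suc (zigzag (suc (toℕ j)))   ≡⟨ cong (suc ∘′ zigzag) (toℕ-one-< j j+1<n) ⟨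
    suc (zigzag (toℕ (one j)))   ∎)
    where open ≡-Reasoning
  ... | inj₂ last = begin
    zigzag (toℕ j)               ≡⟨ zigzag-≥ (¬below⇒≥ ¬b) ⟩
    K ∸ toℕ j                    ≡⟨ K∸last last ⟩
    1 + g                        ≈⟨ +m-≋ 1 ⟩
    1                            ≡⟨ cong (suc ∘′ zigzag) (toℕ-one-last j last) ⟨
    suc (zigzag (toℕ (one j)))   ∎
    where open ≋-Reasoning

  zigzagProfile : LevelProfile G n
  zigzagProfile = record
    { height  = λ j → zigzag (toℕ j)
    ; ascends = below
    ; ascend  = zigzag-ascend
    ; descend = zigzag-descend
    }

  zigzagPair : Bool → LevelProfile G n
  zigzagPair = mirrorPair zigzagProfile K (λ j → zigzag-≤K (toℕ j))

  zigzagPair-directions : ∀ j d → ExactlyOne Bool (λ b → LevelProfile.ascends (zigzagPair b) j ≡ d)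
  zigzagPair-directions = mirrorPair-directions zigzagProfile K (λ j → zigzag-≤K (toℕ j))

module _ (t : ℕ) where

  tag : Fin (t + t) → Fin t × Bool
  tag f = [ (_, true) , (_, false) ]′ (splitAt t f)

  untag : Fin t × Bool → Fin (t + t)
  untag (k , true)  = join t t (inj₁ k)
  untag (k , false) = join t t (inj₂ k)

  tag-untag : ∀ kb → tag (untag kb) ≡ kb
  tag-untag (k , true)  = cong [ (_, true) , (_, false) ]′ (splitAt-join t t (inj₁ k))
  tag-untag (k , false) = cong [ (_, true) , (_, false) ]′ (splitAt-join t t (inj₂ k))

  untag-tag : ∀ f → untag (tag f) ≡ f
  untag-tag f with splitAt t f | join-splitAt t t f
  ... | inj₁ k | e = e
  ... | inj₂ k | e = e

module Construction {N G : ℕ} {S : Subset (suc N)}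
  (h : ℕ) (n+g≡h+h : suc N + suc G ≡ h + h) (g≤n : suc G ≤ suc N) (3≤g : 3 ≤ suc G)
  {t : ℕ} (H : Fin t → HamCycle (Circ (suc N) S))
  (H-partition : ∀ x y → Adj (Circ (suc N) S) x y → ExactlyOne (Fin t) (λ k → cyc (H k) ∋edge x ─ y))
  where
  private
    n = suc N
    g = suc G
  open Zigzag h n+g≡h+h g≤n
  open Lifting using (liftCycle; liftFactor; liftCycle-project; lift-cover)

  hamilton : (k : Fin t) → Resized n (cyc (H k))
  hamilton k = resize (HamCycle-length (H k)) (cyc (H k))

  C : Fin t → Cycle (Circ n S) n
  C k = Resized.cycle (hamilton k)

  factor : Fin t × Bool → CFactor n (Cg g n S)
  factor kb = liftFactor (C k) (zigzagPair b) (Resized.spanning⇒ (hamilton k) (spanning (H k)))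
    where
      k = proj₁ kb
      b = proj₂ kb

  Index : Set
  Index = Σ (Fin (t + t)) (λ _ → Fin g)

  reshape : Index → Fin t × (Bool × Fin g)
  reshape (f , c) = proj₁ (tag t f) , proj₂ (tag t f) , c

  unreshape : Fin t × (Bool × Fin g) → Index
  unreshape (k , b , c) = untag t (k , b) , c

  covered-once : ∀ i x y → Adj (Circ n S) x y →
                 ExactlyOne Index (λ (f , c) → cycles (factor (tag t f)) c ∋edge (i , x) ─ (one i , y))
  covered-once i x y xy =
    ExactlyOne-reindex reshape unreshape
      (λ (k , b , c) → cong (λ kb → proj₁ kb , proj₂ kb , c) (tag-untag t (k , b)))
      (λ (f , c) → cong (_, c) (untag-tag t f))
      (ExactlyOne-× (H-partition x y xy)
        (λ k e → lift-cover (C k) 3≤g zigzagPair zigzagPair-directions (Resized.edge⇒ (hamilton k) e))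
        (λ k (b , c) e → Resized.edge⇐ (hamilton k) (liftCycle-project (C k) (zigzagPair b) {c} e)))

  factorization : CFactorization n (Cg g n S)
  factorization = t + t , (λ f → factor (tag t f)) , partition
    where
      D : Index → Cycle (Cg g n S) n
      D (f , c) = cycles (factor (tag t f)) c

      partition : EdgePartition (Cg g n S) Index D
      partition (i , x) (_ , y) (inj₁ (refl , xy)) = covered-once i x y xy
      partition (_ , x) (i , y) (inj₂ (refl , yx)) =
        ExactlyOne-map (λ w → ∋edge-sym {C = D w}) (λ w → ∋edge-sym {C = D w}) (covered-once i y x yx)

odd+odd≡h+h : ∀ a b → suc (2 * a) + suc (2 * b) ≡ suc (a + b) + suc (a + b)
odd+odd≡h+h = solve-∀

mainTheorem2 : (n g : ℕ) → Odd n → Odd g → 3 ≤ g → g ≤ n →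
    (S : Subset n) → (∀ (z : Fin n) → toℕ z ≡ 0 → z ∉ S) →
    HamiltonianDecomposition (Circ n S) → CFactorization n (Cg g n S)
mainTheorem2 _ _ (a , refl) (b , refl) 3≤g g≤n S _ (t , H , H-partition) =
  Construction.factorization (suc (a + b)) (odd+odd≡h+h a b) g≤n 3≤g H H-partition
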